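{- Let $L$ be a Brouwer algebra and let $b_1,\dots,b_n$ be an antichain of join-irreducible elements of $L$ with $1=b_1+\cdots+b_n$. Then for every $a\in L$ there is a subset $I\subseteq\{1,\dots,n\}$ with $\neg a=\sum_{i\in I}b_i$ (where the empty join is $0$). In particular, $\neg b_i=\sum_{j\ne i}b_j$ for each $i$.
   Context: A Brouwer algebra is a bounded distributive lattice $\langle L,+,\times,0,1\rangle$ ($+$ = join, $\times$ = meet) with a binary operation $\rightarrow$ satisfying $b\le a+c\iff a\rightarrow b\le c$ (so $a\rightarrow b$ is the least $c$ with $b\le a+c$), and $\neg a=a\rightarrow 1$. An element $x$ is join-irreducible iff $x\le y+z$ implies $x\le y$ or $x\le z$. -}

module Defs where

open import Level using (Level; _⊔_) renaming (suc to lsuc)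
open import Data.Nat using (ℕ; zero; suc)
open import Data.Fin using (Fin; zero; suc)
open import Data.Fin.Subset using (Subset; _∈_)
open import Data.Vec using (Vec; []; _∷_)
open import Data.Bool using (Bool; true; false)
open import Data.Sum using (_⊎_)
open import Relation.Nullary using (¬_)
open import Relation.Binary.PropositionalEquality using (_≢_)
open import Relation.Binary.Core using (Rel)
open import Algebra.Core using (Op₂)
open import Algebra.Lattice.Structures using (IsDistributiveLattice)
open import Algebra.Lattice.Bundles using (DistributiveLattice)
open import Function.Bundles using (_⇔_)

-- A Brouwer algebra: a bounded distributive lattice ⟨L,+,×,0,1⟩
-- (+ = join = _∨_, × = meet = _∧_) with an operation _⇒_ such that
--   b ≤ a + c  iff  a ⇒ b ≤ c.
record BrouwerAlgebra (c ℓ : Level) : Set (lsuc (c ⊔ ℓ)) where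
  infixr 7 _∧_
  infixr 6 _∨_
  infixr 5 _⇒_
  infix  4 _≈_ _≤_
  field
    Carrier               : Set c
    _≈_                   : Rel Carrier ℓ
    _∨_                   : Op₂ Carrier
    _∧_                   : Op₂ Carrier
    _⇒_                   : Op₂ Carrier
    𝟘                     : Carrier
    𝟙                     : Carrier
    isDistributiveLattice : IsDistributiveLattice _≈_ _∨_ _∧_

  _≤_ : Rel Carrier ℓ
  x ≤ y = (x ∨ y) ≈ y

  field
    𝟘-least   : ∀ x → 𝟘 ≤ x
    𝟙-greatest : ∀ x → x ≤ 𝟙
    ⇒-adjoint : ∀ a b c → (b ≤ a ∨ c) ⇔ (a ⇒ b ≤ c)

  open IsDistributiveLattice isDistributiveLattice public

  ∼_ : Carrier → Carrier
  ∼ a = a ⇒ 𝟙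

  JoinIrreducible : Carrier → Set (c ⊔ ℓ)
  JoinIrreducible x = ∀ y z → x ≤ y ∨ z → (x ≤ y) ⊎ (x ≤ z)

  ⋁ : ∀ {n} → (Fin n → Carrier) → Carrier
  ⋁ {zero}  b = 𝟘
  ⋁ {suc n} b = b zero ∨ ⋁ (λ i → b (suc i))

  ⋁[_] : ∀ {n} → Subset n → (Fin n → Carrier) → Carrier
  ⋁[ [] ]        b = 𝟘
  ⋁[ true ∷ I ]  b = b zero ∨ ⋁[ I ] (λ i → b (suc i))
  ⋁[ false ∷ I ] b = ⋁[ I ] (λ i → b (suc i))

  Antichain : ∀ {n} → (Fin n → Carrier) → Set ℓ
  Antichain b = ∀ i j → i ≢ j → ¬ (b i ≤ b j)

-- Since 𝟙 ≤ a + ¬a, every join-irreducible bᵢ lies below a or below ¬a. Taking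
-- I = {i ∣ bᵢ ≤ ¬a}, the join over I is below ¬a; conversely 𝟙 = ⋁ b ≤ a + ⋁[I] b,
-- so ¬a ≤ ⋁[I] b by adjointness. For a = bᵢ the antichain condition forces
-- bⱼ ≤ ¬bᵢ for every j ≠ i, so I is the complement of {i}.
module Submission where

open import Defs
open import Data.Nat using (ℕ; zero; suc)
open import Data.Fin using (Fin; zero; suc)
open import Data.Fin.Subset using (Subset; _∈_; _∉_; ⁅_⁆; ∁; inside; outside)
open import Data.Fin.Subset.Properties using (_∈?_; x∉∁p⇒x∈p; x∈∁p⇒x∉p; x∈⁅y⁆⇒x≡y; x∉⁅y⁆⇒x≢y)
open import Data.Vec.Base using (_∷_; []; module _[_]=_)
open _[_]=_
open import Data.Product using (Σ; _×_; _,_)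
open import Data.Sum using (_⊎_; inj₁; inj₂)
open import Data.Empty using (⊥-elim)
open import Function using (_∘_)
open import Function.Bundles using (Equivalence)
open import Relation.Nullary using (yes; no)
open import Relation.Binary.PropositionalEquality using (_≢_; cong)
open import Algebra.Lattice.Bundles using (Lattice)
import Algebra.Lattice.Properties.Lattice as LatticeProperties
import Relation.Binary.Lattice as OrderLattice

partition : ∀ {n p q} {P : Fin n → Set p} {Q : Fin n → Set q} →
            (∀ i → P i ⊎ Q i) →
            Σ (Subset n) λ I → (∀ {i} → i ∈ I → Q i) × (∀ {i} → i ∉ I → P i)
partition {zero}  h = [] , (λ ()) , λ { {()} }
partition {suc n} h with partition (h ∘ suc) | h zero
... | I , inI , outI | inj₁ p =
  outside ∷ I , (λ { (there m) → inI m })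
              , (λ { {zero} _ → p ; {suc i} i∉ → outI (i∉ ∘ there) })
... | I , inI , outI | inj₂ q =
  inside ∷ I , (λ { here → q ; (there m) → inI m })
             , (λ { {zero} i∉ → ⊥-elim (i∉ here) ; {suc i} i∉ → outI (i∉ ∘ there) })

module BrouwerProperties {c ℓ} (L : BrouwerAlgebra c ℓ) where
  open BrouwerAlgebra L

  -- The library orders the join-semilattice by y ≈ y ∨ x instead of x ∨ y ≈ y.
  private
    lattice : Lattice c ℓ
    lattice = record { isLattice = isLattice }

    module J = OrderLattice.JoinSemilattice
      (LatticeProperties.∨-orderTheoreticJoinSemilattice lattice)

    toJ : ∀ {x y} → x ≤ y → J._≤_ x y
    toJ {x} {y} x≤y = sym (trans (∨-comm y x) x≤y)

    fromJ : ∀ {x y} → J._≤_ x y → x ≤ y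
    fromJ {x} {y} y≈y∨x = trans (∨-comm x y) (sym y≈y∨x)

  ≤-reflexive : ∀ {x y} → x ≈ y → x ≤ y
  ≤-reflexive = fromJ ∘ J.reflexive

  ≤-refl : ∀ {x} → x ≤ x
  ≤-refl = fromJ J.refl

  ≤-trans : ∀ {x y z} → x ≤ y → y ≤ z → x ≤ z
  ≤-trans p q = fromJ (J.trans (toJ p) (toJ q))

  ≤-antisym : ∀ {x y} → x ≤ y → y ≤ x → x ≈ y
  ≤-antisym p q = J.antisym (toJ p) (toJ q)

  x≤x∨y : ∀ x y → x ≤ x ∨ y
  x≤x∨y x y = fromJ (J.x≤x∨y x y)

  y≤x∨y : ∀ x y → y ≤ x ∨ y
  y≤x∨y x y = fromJ (J.y≤x∨y x y)

  ∨-least : ∀ {x y z} → x ≤ z → y ≤ z → x ∨ y ≤ z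
  ∨-least p q = fromJ (J.∨-least (toJ p) (toJ q))

  ⋁-least : ∀ {n} (b : Fin n → Carrier) {z} → (∀ i → b i ≤ z) → ⋁ b ≤ z
  ⋁-least {zero}  b h = 𝟘-least _
  ⋁-least {suc n} b h = ∨-least (h zero) (⋁-least (b ∘ suc) (h ∘ suc))

  ⋁[]-least : ∀ {n} (I : Subset n) (b : Fin n → Carrier) {z} →
              (∀ {i} → i ∈ I → b i ≤ z) → ⋁[ I ] b ≤ z
  ⋁[]-least []            b h = 𝟘-least _
  ⋁[]-least (inside ∷ I)  b h = ∨-least (h here) (⋁[]-least I (b ∘ suc) (h ∘ there))
  ⋁[]-least (outside ∷ I) b h = ⋁[]-least I (b ∘ suc) (h ∘ there)

  x∈I⇒≤⋁[I] : ∀ {n} (I : Subset n) (b : Fin n → Carrier) {i} → i ∈ I → b i ≤ ⋁[ I ] b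
  x∈I⇒≤⋁[I] (inside ∷ I)  b here      = x≤x∨y _ _
  x∈I⇒≤⋁[I] (inside ∷ I)  b (there m) = ≤-trans (x∈I⇒≤⋁[I] I (b ∘ suc) m) (y≤x∨y _ _)
  x∈I⇒≤⋁[I] (outside ∷ I) b (there m) = x∈I⇒≤⋁[I] I (b ∘ suc) m

  ∼-least : ∀ {a x} → 𝟙 ≤ a ∨ x → ∼ a ≤ x
  ∼-least {a} {x} = Equivalence.to (⇒-adjoint a 𝟙 x)

  𝟙≤x∨∼x : ∀ x → 𝟙 ≤ x ∨ ∼ x
  𝟙≤x∨∼x x = Equivalence.from (⇒-adjoint x 𝟙 (∼ x)) ≤-refl

  joinIrreducible⇒≤x⊎≤∼x : ∀ {y} → JoinIrreducible y → ∀ x → y ≤ x ⊎ y ≤ ∼ x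
  joinIrreducible⇒≤x⊎≤∼x {y} ji x = ji x (∼ x) (≤-trans (𝟙-greatest y) (𝟙≤x∨∼x x))

  ∼≈⋁[] : ∀ {n} (b : Fin n → Carrier) (I : Subset n) {a} → 𝟙 ≤ ⋁ b →
          (∀ {i} → i ∈ I → b i ≤ ∼ a) → (∀ {i} → i ∉ I → b i ≤ a) →
          ∼ a ≈ ⋁[ I ] b
  ∼≈⋁[] b I {a} 𝟙≤⋁b inI outI =
    ≤-antisym (∼-least (≤-trans 𝟙≤⋁b (⋁-least b covered))) (⋁[]-least I b inI)
    where
    covered : ∀ i → b i ≤ a ∨ ⋁[ I ] b
    covered i with i ∈? I
    ... | yes i∈I = ≤-trans (x∈I⇒≤⋁[I] I b i∈I) (y≤x∨y _ _)
    ... | no  i∉I = ≤-trans (outI i∉I) (x≤x∨y _ _)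

  antichain⇒≤∼ : ∀ {n} {b : Fin n → Carrier} → Antichain b →
                 ∀ {i j} → JoinIrreducible (b j) → j ≢ i → b j ≤ ∼ b i
  antichain⇒≤∼ {b = b} anti {i} {j} ji j≢i with joinIrreducible⇒≤x⊎≤∼x ji (b i)
  ... | inj₁ bj≤bi  = ⊥-elim (anti j i j≢i bj≤bi)
  ... | inj₂ bj≤∼bi = bj≤∼bi

lemma3p7 : ∀ {c ℓ} (L : BrouwerAlgebra c ℓ) (n : ℕ) (b : Fin n → BrouwerAlgebra.Carrier L) →
    BrouwerAlgebra.Antichain L b →
    (∀ i → BrouwerAlgebra.JoinIrreducible L (b i)) →
    BrouwerAlgebra._≈_ L (BrouwerAlgebra.𝟙 L) (BrouwerAlgebra.⋁ L b) →
    (∀ a → Σ (Subset n) λ I → BrouwerAlgebra._≈_ L (BrouwerAlgebra.∼_ L a) (BrouwerAlgebra.⋁[_] L I b))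
    × (∀ i → BrouwerAlgebra._≈_ L (BrouwerAlgebra.∼_ L (b i)) (BrouwerAlgebra.⋁[_] L (∁ ⁅ i ⁆) b))
lemma3p7 L n b anti ji top = ∼-of-any , ∼-of-member
  where
  open BrouwerAlgebra L
  open BrouwerProperties L

  𝟙≤⋁b : 𝟙 ≤ ⋁ b
  𝟙≤⋁b = ≤-reflexive top

  ∼-of-any : ∀ a → Σ (Subset n) λ I → ∼ a ≈ ⋁[ I ] b
  ∼-of-any a with partition (λ i → joinIrreducible⇒≤x⊎≤∼x (ji i) a)
  ... | I , inI , outI = I , ∼≈⋁[] b I 𝟙≤⋁b inI outI

  ∼-of-member : ∀ i → ∼ b i ≈ ⋁[ ∁ ⁅ i ⁆ ] b
  ∼-of-member i = ∼≈⋁[] b (∁ ⁅ i ⁆) 𝟙≤⋁b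
    (λ j∈ → antichain⇒≤∼ anti (ji _) (x∉⁅y⁆⇒x≢y (x∈∁p⇒x∉p j∈)))
    (λ j∉ → ≤-reflexive (reflexive (cong b (x∈⁅y⁆⇒x≡y i (x∉∁p⇒x∈p j∉)))))
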